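{- Let $(a_n)_{n\in\mathbf{N}}$ be a sequence in $\mathcal{C}$ and let $w_a(x,y)$ be a palindromic factor of it with $y$ odd. Then $y=1$ or $y=3$.
   Context: $w_a(x,y)=a_xa_{x+1}\cdots a_{x+y-1}$ denotes the factor of length $y$ starting at position $x$. A word is palindromic if it equals its reversal. The class $\mathcal{C}$: let $\Sigma$ be an alphabet with at least two letters and $a\in\Sigma$. For a bijection $g$ of $\Sigma$ and a word $u$, $g(u)$ is the letter-by-letter image. Let $(f_n)_{n\ge0}$ be bijections of $\Sigma$ and define $w_0=a$, $w_n=w_{n-1}f_{n-1}(w_{n-1})f_{n-1}(w_{n-1})w_{n-1}$ for $n>0$, with the requirement $f_n(w_n)\neq w_n$ for all $n\ge0$. The limit infinite sequence is in $\mathcal{C}$; $\mathcal{C}$ is the set of all such limits. -}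

module Defs where

open import Data.Nat using (ℕ; zero; suc; _+_; _*_; _<_)
open import Data.Fin using (Fin; fromℕ<)
open import Data.Fin.Permutation using (Permutation′; _⟨$⟩ʳ_)
open import Data.List using (List; [_]; _++_; map; length; lookup; reverse; upTo)
open import Data.Product using (Σ; _×_)
open import Relation.Binary.PropositionalEquality using (_≡_; _≢_)

-- Alphabet Σ = Fin k (a finite alphabet; the statement requires 2 ≤ k).
-- A bijection of the alphabet is a permutation; g(u) is the letter-by-letter image.
applyPerm : ∀ {k} → Permutation′ k → List (Fin k) → List (Fin k)
applyPerm g u = map (g ⟨$⟩ʳ_) u

w : ∀ {k} → Fin k → (ℕ → Permutation′ k) → ℕ → List (Fin k)
w a f zero    = [ a ]
w a f (suc n) = w a f n ++ applyPerm (f n) (w a f n) ++ applyPerm (f n) (w a f n) ++ w a f n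

-- The sequence s (indexed from 0) is the limit of (w_n) for the data (a, f):
-- every w_n is a prefix of s.
IsLimit : ∀ {k} → Fin k → (ℕ → Permutation′ k) → (ℕ → Fin k) → Set
IsLimit a f s = ∀ n i (h : i < length (w a f n)) → s i ≡ lookup (w a f n) (fromℕ< h)

InC : ∀ {k} → (ℕ → Fin k) → Set
InC {k} s = Σ (Fin k) λ a → Σ (ℕ → Permutation′ k) λ f →
  (∀ n → applyPerm (f n) (w a f n) ≢ w a f n) × IsLimit a f s

factor : ∀ {k} → (ℕ → Fin k) → ℕ → ℕ → List (Fin k)
factor s x y = map (λ i → s (x + i)) (upTo y)

Palindromic : ∀ {k} → List (Fin k) → Set
Palindromic u = reverse u ≡ u

module Submission where

open import Defs
open import Data.Nat using (ℕ; _≤_; _+_; _*_)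
open import Data.Fin using (Fin)
open import Data.Product using (∃)
open import Data.Sum using (_⊎_)
open import Relation.Binary.PropositionalEquality using (_≡_)

open import Data.Empty using (⊥-elim)
open import Data.Fin using (fromℕ<; toℕ)
open import Data.Fin.Permutation using (Permutation′; _⟨$⟩ʳ_)
open import Data.Fin.Properties using (toℕ-fromℕ<)
open import Data.List using (List; []; _∷_; [_]; _++_; map; length; lookup; reverse; upTo;
  applyUpTo; applyDownFrom)
open import Data.List.Properties using (length-++; length-map; map-upTo; reverse-applyUpTo;
  lookup-applyUpTo; lookup-applyDownFrom; length-applyUpTo; length-applyDownFrom)
open import Data.Nat using (zero; suc; _<_; _∸_; z≤n; z<s; s<s)
open import Data.Nat.Properties using (+-commutativeSemigroup; +-suc; m<m+n; m≤m+n; m+n∸m≡n;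
  <⇒≤; ≤-<-trans; <-≤-trans)
open import Algebra.Properties.CommutativeSemigroup +-commutativeSemigroup using (x∙yz≈y∙xz)
open import Data.Nat.Tactic.RingSolver using (solve-∀)
open import Data.Product using (_,_)
open import Data.Sum using (inj₁; inj₂)
open import Function using (_∘_)
open import Function.Bundles using (Injection)
open import Function.Definitions using (Injective)
open import Function.Properties.Inverse using (↔⇒↣)
open import Relation.Binary.PropositionalEquality using (_≢_; refl; sym; trans; cong; subst; ≢-sym;
  module ≡-Reasoning)

-- Every w_{n+1}, hence the sequence itself, is a concatenation of blocks c d d c with c ≠ d,
-- the blocks starting at the multiples of 4. A palindrome of odd length at least 5 is centred
-- on a palindrome u v z v u of length 5, and wherever such a window sits relative to the
-- block boundaries it forces two letters of one block c d d c to coincide.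

private
  variable
    A : Set

data Abba {A : Set} : List A → Set where
  []   : Abba []
  abba : ∀ {c d L} → c ≢ d → Abba L → Abba (c ∷ d ∷ d ∷ c ∷ L)

Abba-++ : ∀ {L M : List A} → Abba L → Abba M → Abba (L ++ M)
Abba-++ []           M = M
Abba-++ (abba c≢d L) M = abba c≢d (Abba-++ L M)

Abba-map : ∀ {g : A → A} → Injective _≡_ _≡_ g → ∀ {L} → Abba L → Abba (map g L)
Abba-map g-inj []           = []
Abba-map g-inj (abba c≢d L) = abba (c≢d ∘ g-inj) (Abba-map g-inj L)

module _ {k : ℕ} (a : Fin k) (f : ℕ → Permutation′ k) where

  w-abba : f 0 ⟨$⟩ʳ a ≢ a → ∀ n → Abba (w a f (suc n))
  w-abba fa≢a zero    = abba (≢-sym fa≢a) []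
  w-abba fa≢a (suc n) = Abba-++ W (Abba-++ fW (Abba-++ fW W))
    where
    W  = w-abba fa≢a n
    fW = Abba-map (Injection.injective (↔⇒↣ (f (suc n)))) W

  length-w-suc : ∀ n → let ℓ = length (w a f n) in length (w a f (suc n)) ≡ ℓ + (ℓ + (ℓ + ℓ))
  length-w-suc n = begin
    length (W ++ fW ++ fW ++ W)                         ≡⟨ length-++ W ⟩
    length W + length (fW ++ fW ++ W)                   ≡⟨ cong (length W +_) (length-++ fW) ⟩
    length W + (length fW + length (fW ++ W))           ≡⟨ cong (λ l → length W + (length fW + l)) (length-++ fW) ⟩
    length W + (length fW + (length fW + length W))     ≡⟨ cong (λ l → length W + (l + (l + length W))) (length-map _ W) ⟩
    length W + (length W + (length W + length W))       ∎
    where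
    open ≡-Reasoning
    W  = w a f n
    fW = applyPerm (f n) W

  n<length-w : ∀ n → n < length (w a f n)
  n<length-w zero    = z<s
  n<length-w (suc n) = subst (suc n <_) (sym (length-w-suc n))
    (≤-<-trans ih (m<m+n ℓ (<-≤-trans ℓ>0 (m≤m+n ℓ (ℓ + ℓ)))))
    where
    ℓ  = length (w a f n)
    ih = n<length-w n
    ℓ>0 : 0 < ℓ
    ℓ>0 = ≤-<-trans z≤n ih

Prefix : List A → (ℕ → A) → Set
Prefix L s = ∀ i (h : i < length L) → s i ≡ lookup L (fromℕ< h)

record AbbaAt (s : ℕ → A) (p : ℕ) : Set where
  field
    outer    : s p ≡ s (3 + p)
    inner    : s (1 + p) ≡ s (2 + p)
    distinct : s p ≢ s (1 + p)

AbbaSequence : (ℕ → A) → Set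
AbbaSequence s = ∀ q → AbbaAt s (q * 4)

AbbaAt-shift : ∀ {s : ℕ → A} {p} → AbbaAt (λ i → s (4 + i)) p → AbbaAt s (4 + p)
AbbaAt-shift block = record { AbbaAt block }

AbbaAt-prefix : ∀ {L} {s : ℕ → A} → Abba L → Prefix L s → ∀ q → 3 + q * 4 < length L →
                AbbaAt s (q * 4)
AbbaAt-prefix (abba c≢d _) s≼ zero    h = record
  { outer    = trans (s≼ 0 z<s) (sym (s≼ 3 h))
  ; inner    = trans (s≼ 1 (s<s z<s)) (sym (s≼ 2 (s<s (s<s z<s))))
  ; distinct = λ e → c≢d (trans (sym (s≼ 0 z<s)) (trans e (s≼ 1 (s<s z<s))))
  }
AbbaAt-prefix (abba _ L) s≼ (suc q) (s<s (s<s (s<s (s<s h)))) =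
  AbbaAt-shift (AbbaAt-prefix L (λ i h → s≼ (4 + i) (s<s (s<s (s<s (s<s h))))) q h)

InC⇒AbbaSequence : ∀ {k} {s : ℕ → Fin k} → InC s → AbbaSequence s
InC⇒AbbaSequence (a , f , f≢ , lim) q =
  AbbaAt-prefix (w-abba a f (f≢ 0 ∘ cong [_]) n) (lim (suc n)) q (<⇒≤ (n<length-w a f (suc n)))
  where n = 3 + q * 4

data Residue4 : ℕ → Set where
  0+4* : ∀ q → Residue4 (q * 4)
  1+4* : ∀ q → Residue4 (1 + q * 4)
  2+4* : ∀ q → Residue4 (2 + q * 4)
  3+4* : ∀ q → Residue4 (3 + q * 4)

residue4 : ∀ p → Residue4 p
residue4 zero = 0+4* 0
residue4 (suc p) with residue4 p
... | 0+4* q = 1+4* q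
... | 1+4* q = 2+4* q
... | 2+4* q = 3+4* q
... | 3+4* q = 0+4* (suc q)

AbbaSequence-no-palindrome₅ : ∀ {s : ℕ → A} → AbbaSequence s →
                              ∀ p → s p ≡ s (4 + p) → s (1 + p) ≢ s (3 + p)
AbbaSequence-no-palindrome₅ {s = s} block p ends mid with residue4 p
... | 0+4* q = distinct (block q) (trans (outer (block q)) (sym mid))
  where open AbbaAt
... | 1+4* q = distinct (block (suc q)) (begin
  s (4 + q * 4)  ≡⟨ sym mid ⟩
  s (2 + q * 4)  ≡⟨ sym (inner (block q)) ⟩
  s (1 + q * 4)  ≡⟨ ends ⟩
  s (5 + q * 4)  ∎)
  where open AbbaAt; open ≡-Reasoning
... | 2+4* q = distinct (block q) (begin
  s (q * 4)      ≡⟨ outer (block q) ⟩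
  s (3 + q * 4)  ≡⟨ mid ⟩
  s (5 + q * 4)  ≡⟨ inner (block (suc q)) ⟩
  s (6 + q * 4)  ≡⟨ sym ends ⟩
  s (2 + q * 4)  ≡⟨ sym (inner (block q)) ⟩
  s (1 + q * 4)  ∎)
  where open AbbaAt; open ≡-Reasoning
... | 3+4* q = distinct (block (suc q)) (trans mid (sym (inner (block (suc q)))))
  where open AbbaAt

lookup-cong : ∀ {L M : List A} → L ≡ M → ∀ {i} (hL : i < length L) (hM : i < length M) →
              lookup L (fromℕ< hL) ≡ lookup M (fromℕ< hM)
lookup-cong refl _ _ = refl

palindrome-mirror : ∀ (g : ℕ → A) {n} i j → i + suc j ≡ n →
                    reverse (map g (upTo n)) ≡ map g (upTo n) → g j ≡ g i
palindrome-mirror g {n} i j i+1+j≡n pal = begin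
  g j                                        ≡⟨ cong g (sym n∸1+i≡j) ⟩
  g (n ∸ suc i)                              ≡⟨ cong (λ t → g (n ∸ suc t)) (sym (toℕ-fromℕ< hDown)) ⟩
  g (n ∸ suc (toℕ (fromℕ< hDown)))           ≡⟨ sym (lookup-applyDownFrom g n (fromℕ< hDown)) ⟩
  lookup (applyDownFrom g n) (fromℕ< hDown)  ≡⟨ lookup-cong down≡up hDown hUp ⟩
  lookup (applyUpTo g n) (fromℕ< hUp)        ≡⟨ lookup-applyUpTo g n (fromℕ< hUp) ⟩
  g (toℕ (fromℕ< hUp))                       ≡⟨ cong g (toℕ-fromℕ< hUp) ⟩
  g i                                        ∎
  where
  open ≡-Reasoning
  down≡up : applyDownFrom g n ≡ applyUpTo g n
  down≡up = begin
    applyDownFrom g n         ≡⟨ sym (reverse-applyUpTo g n) ⟩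
    reverse (applyUpTo g n)   ≡⟨ cong reverse (sym (map-upTo g n)) ⟩
    reverse (map g (upTo n))  ≡⟨ pal ⟩
    map g (upTo n)            ≡⟨ map-upTo g n ⟩
    applyUpTo g n             ∎
  i<n : i < n
  i<n = subst (i <_) i+1+j≡n (m<m+n i z<s)
  hDown : i < length (applyDownFrom g n)
  hDown = subst (i <_) (sym (length-applyDownFrom g n)) i<n
  hUp : i < length (applyUpTo g n)
  hUp = subst (i <_) (sym (length-applyUpTo g n)) i<n
  n∸1+i≡j : n ∸ suc i ≡ j
  n∸1+i≡j = trans (cong (_∸ suc i) (trans (sym i+1+j≡n) (+-suc i j))) (m+n∸m≡n (suc i) j)

lemma2 : (k : ℕ) → 2 ≤ k → (s : ℕ → Fin k) → InC s →
    (x y : ℕ) → Palindromic (factor s x y) → (∃ λ m → y ≡ 1 + 2 * m) →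
    y ≡ 1 ⊎ y ≡ 3
lemma2 k _ s inC x y pal (0 , refl)    = inj₁ refl
lemma2 k _ s inC x y pal (1 , refl)    = inj₂ refl
lemma2 k _ s inC x y pal (suc (suc m) , refl) =
  ⊥-elim (AbbaSequence-no-palindrome₅ (InC⇒AbbaSequence inC) (x + m) ends mid)
  where
  g : ℕ → Fin k
  g i = s (x + i)
  split-at-m : ∀ n → n + suc (4 + n) ≡ 1 + 2 * suc (suc n)
  split-at-m = solve-∀
  split-at-1+m : ∀ n → suc n + suc (3 + n) ≡ 1 + 2 * suc (suc n)
  split-at-1+m = solve-∀
  open ≡-Reasoning
  ends : s (x + m) ≡ s (4 + (x + m))
  ends = begin
    g m              ≡⟨ sym (palindrome-mirror g m (4 + m) (split-at-m m) pal) ⟩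
    g (4 + m)        ≡⟨ cong s (x∙yz≈y∙xz x 4 m) ⟩
    s (4 + (x + m))  ∎
  mid : s (1 + (x + m)) ≡ s (3 + (x + m))
  mid = begin
    s (1 + (x + m))  ≡⟨ cong s (sym (x∙yz≈y∙xz x 1 m)) ⟩
    g (suc m)        ≡⟨ sym (palindrome-mirror g (suc m) (3 + m) (split-at-1+m m) pal) ⟩
    g (3 + m)        ≡⟨ cong s (x∙yz≈y∙xz x 3 m) ⟩
    s (3 + (x + m))  ∎
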